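{- Let $G$ be a graph and $U\subseteq V(G)$ a strong edge geodetic set of $G$. If $v$ is a dominant neighbor of $u$, then $u\in U$. In particular, if $u$ and $v$ are twin vertices, then $u\in U$ and $v\in U$.
   Context: All graphs are finite and simple. For a graph $G$, a set $S\subseteq V(G)$ is a strong edge geodetic set if to each (unordered) pair of vertices $x,y\in S$ one can assign one shortest $x,y$-path (or no path) such that every edge of $G$ lies on at least one of the assigned paths. $N[u]=\{u\}\cup\{x : ux\in E(G)\}$ is the closed neighborhood of $u$. A vertex $v$ is a dominant neighbor of $u$ if $uv\in E(G)$ and $N[u]\subseteq N[v]$. Vertices $u,v$ are twins if $N[u]=N[v]$. -}

module Defs where

open import Data.Nat using (ℕ; zero; suc; _≤_)
open import Data.Fin using (Fin; _<_)
open import Data.Fin.Subset using (Subset; _∈_)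
open import Data.List using (List; []; _∷_)
open import Data.List.Relation.Unary.Unique.Propositional using (Unique)
open import Data.Maybe using (Maybe; just; nothing)
open import Data.Product using (Σ; ∃; _×_; _,_)
open import Data.Sum using (_⊎_)
open import Relation.Binary.PropositionalEquality using (_≡_)
open import Relation.Nullary using (¬_)

record Graph (n : ℕ) : Set₁ where
  field
    _~_    : Fin n → Fin n → Set
    ~-sym  : ∀ {x y} → x ~ y → y ~ x
    ~-irr  : ∀ {x} → ¬ (x ~ x)

module _ {n : ℕ} (G : Graph n) where
  open Graph G

  data Walk : Fin n → Fin n → Set where
    []  : ∀ {x} → Walk x x
    _∷_ : ∀ {x y z} → x ~ y → Walk y z → Walk x z

  walkLength : ∀ {x y} → Walk x y → ℕ
  walkLength []      = zero
  walkLength (_ ∷ w) = suc (walkLength w)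

  vertices : ∀ {x y} → Walk x y → List (Fin n)
  vertices {x} []      = x ∷ []
  vertices {x} (_ ∷ w) = x ∷ vertices w

  data EdgeOn (a b : Fin n) : ∀ {x y} → Walk x y → Set where
    here  : ∀ {x y z} (e : x ~ y) (w : Walk y z) →
            ((x ≡ a × y ≡ b) ⊎ (x ≡ b × y ≡ a)) → EdgeOn a b (e ∷ w)
    there : ∀ {x y z} (e : x ~ y) {w : Walk y z} → EdgeOn a b w → EdgeOn a b (e ∷ w)

  IsPath : ∀ {x y} → Walk x y → Set
  IsPath w = Unique (vertices w)

  record ShortestPath (x y : Fin n) : Set where
    field
      walk     : Walk x y
      isPath   : IsPath walk
      shortest : ∀ (q : Walk x y) → IsPath q → walkLength walk ≤ walkLength q

  -- strong edge geodetic set: to each unordered pair {x,y} ⊆ S (represented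
  -- as x < y) assign one shortest x,y-path or no path, such that every edge
  -- of G lies on at least one assigned path.
  IsStrongEdgeGeodetic : Subset n → Set
  IsStrongEdgeGeodetic S =
    Σ (∀ x y → x ∈ S → y ∈ S → x < y → Maybe (ShortestPath x y)) λ f →
      ∀ {a b} → a ~ b →
        ∃ λ x → ∃ λ y → ∃ λ (xS : x ∈ S) → ∃ λ (yS : y ∈ S) → ∃ λ (lt : x < y) →
          ∃ λ (p : ShortestPath x y) →
            (f x y xS yS lt ≡ just p) × EdgeOn a b (ShortestPath.walk p)

  N[_] : Fin n → Fin n → Set
  N[ u ] x = x ≡ u ⊎ u ~ x

  DominantNeighbor : Fin n → Fin n → Set
  DominantNeighbor v u = (u ~ v) × (∀ x → N[ u ] x → N[ v ] x)

  Twins : Fin n → Fin n → Set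
  Twins u v = ∀ x → (N[ u ] x → N[ v ] x) × (N[ v ] x → N[ u ] x)

-- If the edge uv lies on a shortest path P and u is an interior vertex of P, then
-- the other neighbour t of u on P is a neighbour of u different from v, hence
-- adjacent to v; replacing the segment through u by the edge {v,t} gives a
-- strictly shorter path between the same endpoints. So u is an end of P, and the
-- ends of the assigned paths lie in U. Twins are dominant neighbours of each other.
module Submission where

open import Defs
open import Data.Nat using (ℕ; suc; s≤s) renaming (_<_ to _<ℕ_)
open import Data.Nat.Properties using (≤-refl; <⇒≱)
open import Data.Fin using (Fin; _≟_)
open import Data.Fin.Subset using (Subset; _∈_)
open import Data.List using (List; _∷_)
open import Data.List.Membership.Propositional using () renaming (_∈_ to _∈ˡ_)
open import Data.List.Relation.Unary.Any using (here; there)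
open import Data.List.Relation.Unary.All using (lookup)
open import Data.List.Relation.Unary.AllPairs using (_∷_)
open import Data.List.Relation.Unary.Unique.Propositional using (Unique)
open import Data.List.Relation.Binary.Sublist.Propositional using (_⊆_; []; _∷_; _∷ʳ_; ⊆-refl)
open import Data.List.Relation.Binary.Sublist.Propositional.Properties using (All-resp-⊆)
open import Data.Product using (_×_; _,_; proj₁; proj₂; swap)
open import Data.Sum using (_⊎_; inj₁; inj₂)
open import Data.Empty using (⊥-elim)
open import Relation.Nullary using (yes; no; ¬_)
open import Relation.Binary.PropositionalEquality using (_≡_; _≢_; refl; ≢-sym)

Unique-resp-⊆ : ∀ {a} {A : Set a} {xs ys : List A} → xs ⊆ ys → Unique ys → Unique xs
Unique-resp-⊆ []         u        = u
Unique-resp-⊆ (_ ∷ʳ p)   (_ ∷ u)  = Unique-resp-⊆ p u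
Unique-resp-⊆ (refl ∷ p) (x∉ ∷ u) = All-resp-⊆ p x∉ ∷ Unique-resp-⊆ p u

module _ {n : ℕ} (G : Graph n) where
  open Graph G

  head∈vertices : ∀ {x z} (w : Walk G x z) → x ∈ˡ vertices G w
  head∈vertices []      = here refl
  head∈vertices (_ ∷ _) = here refl

  EdgeOn⇒∈ˡ : ∀ {a b x z} {w : Walk G x z} → EdgeOn G a b w → a ∈ˡ vertices G w
  EdgeOn⇒∈ˡ (here _ _ (inj₁ (refl , _))) = here refl
  EdgeOn⇒∈ˡ (here _ w (inj₂ (_ , refl))) = there (head∈vertices w)
  EdgeOn⇒∈ˡ (there _ r)                  = there (EdgeOn⇒∈ˡ r)

  dominantNeighbor-adjacent : ∀ {u v t} → DominantNeighbor G v u → u ~ t → t ≢ v → v ~ t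
  dominantNeighbor-adjacent (_ , N[u]⊆N[v]) u~t t≢v with N[u]⊆N[v] _ (inj₂ u~t)
  ... | inj₁ t≡v = ⊥-elim (t≢v t≡v)
  ... | inj₂ v~t = v~t

  twins-adjacent : ∀ {u v} → u ≢ v → Twins G u v → u ~ v
  twins-adjacent u≢v twins with proj₂ (twins _) (inj₁ refl)
  ... | inj₁ v≡u = ⊥-elim (≢-sym u≢v v≡u)
  ... | inj₂ u~v = u~v

  twins⇒dominantNeighbor : ∀ {u v} → u ≢ v → Twins G u v → DominantNeighbor G v u
  twins⇒dominantNeighbor u≢v twins = twins-adjacent u≢v twins , λ x → proj₁ (twins x)

  record Shortcut {x z} (w : Walk G x z) : Set where
    field
      walk       : Walk G x z
      vertices-⊆ : vertices G walk ⊆ vertices G w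
      shorter    : walkLength G walk <ℕ walkLength G w

  Shortcut-∷ : ∀ {x y z} (e : x ~ y) {w : Walk G y z} → Shortcut w → Shortcut (e ∷ w)
  Shortcut-∷ e s = record
    { walk       = e ∷ walk
    ; vertices-⊆ = refl ∷ vertices-⊆
    ; shorter    = s≤s shorter
    }
    where open Shortcut s

  shortestPath-has-no-shortcut : ∀ {x z} (p : ShortestPath G x z) → ¬ Shortcut (ShortestPath.walk p)
  shortestPath-has-no-shortcut p s =
    <⇒≱ shorter (shortest walk (Unique-resp-⊆ vertices-⊆ isPath))
    where
    open ShortestPath p using (isPath; shortest)
    open Shortcut s

  module _ {u v : Fin n} (dom : DominantNeighbor G v u) where

    common-neighbour-adjacent : ∀ {x t} → x ~ u → u ~ t → x ≢ t → x ≡ v ⊎ t ≡ v → x ~ t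
    common-neighbour-adjacent x~u u~t x≢t (inj₁ refl) =
      dominantNeighbor-adjacent dom u~t (≢-sym x≢t)
    common-neighbour-adjacent x~u u~t x≢t (inj₂ refl) =
      ~-sym (dominantNeighbor-adjacent dom (~-sym x~u) x≢t)

    bypass : ∀ {x t z} (x~u : x ~ u) (u~t : u ~ t) (w : Walk G t z) →
             IsPath G (x~u ∷ u~t ∷ w) → x ≡ v ⊎ t ≡ v → Shortcut (x~u ∷ u~t ∷ w)
    bypass {x} {t} x~u u~t w (x∉ ∷ _) x≡v⊎t≡v = record
      { walk       = common-neighbour-adjacent x~u u~t x≢t x≡v⊎t≡v ∷ w
      ; vertices-⊆ = refl ∷ (_ ∷ʳ ⊆-refl)
      ; shorter    = ≤-refl
      }
      where
      x≢t : x ≢ t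
      x≢t = lookup x∉ (there (head∈vertices w))

    -- On a path entered at u the edge uv must be the next one, as u does not recur.
    bypass-after : ∀ {x z} (x~u : x ~ u) (w : Walk G u z) →
                   IsPath G (x~u ∷ w) → EdgeOn G u v w → Shortcut (x~u ∷ w)
    bypass-after x~u (u~t ∷ w) uq (here _ _ (inj₁ (_ , refl))) = bypass x~u u~t w uq (inj₂ refl)
    bypass-after x~u (u~t ∷ w) uq (here _ _ (inj₂ (refl , _))) = ⊥-elim (~-irr (proj₁ dom))
    bypass-after x~u (u~t ∷ w) (_ ∷ u∉ ∷ _) (there _ r)       = ⊥-elim (lookup u∉ (EdgeOn⇒∈ˡ r) refl)

    interior-shortcut : ∀ {x z} (w : Walk G x z) → IsPath G w → EdgeOn G u v w →
                        u ≢ x → u ≢ z → Shortcut w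
    interior-shortcut _ _  (here _ _ (inj₁ (refl , _)))          u≢x _   = ⊥-elim (u≢x refl)
    interior-shortcut _ _  (here _ [] (inj₂ (_ , refl)))         _   u≢z = ⊥-elim (u≢z refl)
    interior-shortcut _ uq (here v~u (u~t ∷ w) (inj₂ (refl , refl))) _ _ = bypass v~u u~t w uq (inj₁ refl)
    interior-shortcut (_∷_ {y = y} e w) uq@(_ ∷ uq′) (there _ r) u≢x u≢z with u ≟ y
    ... | yes refl = bypass-after e w uq r
    ... | no u≢y   = Shortcut-∷ e (interior-shortcut w uq′ r u≢y u≢z)

    dominated-endpoint : ∀ {x z} (p : ShortestPath G x z) → EdgeOn G u v (ShortestPath.walk p) →
                         u ≡ x ⊎ u ≡ z
    dominated-endpoint {x} {z} p uv-on-p with u ≟ x | u ≟ z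
    ... | yes u≡x | _       = inj₁ u≡x
    ... | no _    | yes u≡z = inj₂ u≡z
    ... | no u≢x  | no u≢z  = ⊥-elim (shortestPath-has-no-shortcut p
            (interior-shortcut (ShortestPath.walk p) (ShortestPath.isPath p) uv-on-p u≢x u≢z))

lemma3p1 : ∀ {n : ℕ} (G : Graph n) (U : Subset n) → IsStrongEdgeGeodetic G U →
    (∀ (u v : Fin n) → DominantNeighbor G v u → u ∈ U)
    × (∀ (u v : Fin n) → u ≢ v → Twins G u v → (u ∈ U) × (v ∈ U))
lemma3p1 {n} G U (_ , covered) = dominated∈U , twins∈U
  where
  dominated∈U : ∀ (u v : Fin n) → DominantNeighbor G v u → u ∈ U
  dominated∈U u v dom with covered (proj₁ dom)
  ... | x , z , x∈U , z∈U , _ , p , _ , uv-on-p with dominated-endpoint G dom p uv-on-p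
  ... | inj₁ refl = x∈U
  ... | inj₂ refl = z∈U

  twins∈U : ∀ (u v : Fin n) → u ≢ v → Twins G u v → (u ∈ U) × (v ∈ U)
  twins∈U u v u≢v twins =
      dominated∈U u v (twins⇒dominantNeighbor G u≢v twins)
    , dominated∈U v u (twins⇒dominantNeighbor G (≢-sym u≢v) (λ x → swap (twins x)))
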